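{- Let $\sigma:\overline{\mathbb F_2}[[X]]\to\overline{\mathbb F_2}[[X]]$ be the quadratic map defined below. Then $\sigma(A^2)=\sigma(A)^2$ for all $A\in\overline{\mathbb F_2}[[X]]$, i.e. $\sigma$ commutes with the Frobenius map $A\mapsto A^2$.
   Context: For $A=\sum_{n\ge0}\alpha_nX^n\in\overline{\mathbb F_2}[[X]]$, $\sigma(A)=\alpha_0^2+\sum_{n\ge0}\alpha_{2^n}^2X^{2^{n+1}}+\sum_{0\le i<j}\binom{i+j}{i}\alpha_i\alpha_jX^{i+j}$ (binomial coefficients reduced mod 2); $A^2$ denotes the ordinary square of $A$. -}

module Defs where

open import Level using (_⊔_)
open import Algebra.Bundles using (CommutativeRing)
open import Data.Nat as ℕ using (ℕ; zero; suc; _∸_; _<?_; _≟_)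
open import Data.Nat.Combinatorics using (_C_)
open import Data.Bool using (Bool; true; false; if_then_else_)
open import Data.List using (List; []; _∷_; length)
open import Data.Product using (∃; _×_)
open import Relation.Nullary using (¬_; does)

module Series {c ℓ} (R : CommutativeRing c ℓ) where
  open CommutativeRing R

  pow : Carrier → ℕ → Carrier
  pow x zero    = 1#
  pow x (suc n) = x * pow x n

  sumTo : ℕ → (ℕ → Carrier) → Carrier
  sumTo zero    f = 0#
  sumTo (suc n) f = sumTo n f + f n

  -- Evaluation of the monic polynomial X^d + c_{d-1}X^{d-1} + … + c_0,
  -- where the coefficient list is cs = c_0 ∷ c_1 ∷ … ∷ c_{d-1}, d = length cs.
  evalLower : List Carrier → Carrier → Carrier
  evalLower []       x = 0#
  evalLower (a ∷ cs) x = a + x * evalLower cs x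

  evalMonic : List Carrier → Carrier → Carrier
  evalMonic cs x = pow x (length cs) + evalLower cs x

  PowerSeries : Set c
  PowerSeries = ℕ → Carrier

  mulPS : PowerSeries → PowerSeries → PowerSeries
  mulPS A B n = sumTo (suc n) (λ i → A i * B (n ∸ i))

  sqPS : PowerSeries → PowerSeries
  sqPS A = mulPS A A

  -- an element of ℤ/2 (given as a natural number) acting on the ring
  oddCoeff : ℕ → Carrier → Carrier
  oddCoeff k x = if does (k ℕ.% 2 ≟ 1) then x else 0#

  -- σ(A) = α_0^2 + Σ_{m≥0} α_{2^m}^2 X^{2^{m+1}} + Σ_{0≤i<j} binom(i+j,i) α_i α_j X^{i+j}
  -- Coefficient of X^n:
  --   [n = 0] α_0^2
  --   + Σ_{m<n, 2^{m+1} = n} α_{2^m}^2      (2^{m+1} = n forces m < n)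
  --   + Σ_{0≤i≤n, i < n-i} (binom(n,i) mod 2) α_i α_{n-i}
  σ : PowerSeries → PowerSeries
  σ A n =
      (if does (n ≟ 0) then A 0 * A 0 else 0#)
    + sumTo n (λ m → if does (ℕ._^_ 2 (suc m) ≟ n)
                        then A (ℕ._^_ 2 m) * A (ℕ._^_ 2 m) else 0#)
    + sumTo (suc n) (λ i → if does (i <? n ∸ i)
                              then oddCoeff (n C i) (A i * A (n ∸ i)) else 0#)

  -- R is (a model of) the algebraic closure of 𝔽₂: a field of characteristic 2,
  -- algebraically closed, and algebraic over 𝔽₂ (every element lies in some 𝔽_{2^n}).
  -- These properties characterise 𝔽₂‾ up to isomorphism.
  record IsAlgClosureF2 : Set (c ⊔ ℓ) where
    field
      nontrivial   : ¬ (1# ≈ 0#)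
      inverses     : ∀ x → ¬ (x ≈ 0#) → ∃ λ y → x * y ≈ 1#
      char2        : 1# + 1# ≈ 0#
      algClosed    : ∀ (a : Carrier) (cs : List Carrier) →
                     ∃ λ x → evalMonic (a ∷ cs) x ≈ 0#
      algebraicF2  : ∀ x → ∃ λ n → pow x (ℕ._^_ 2 (suc n)) ≈ x

module Submission where

-- In characteristic 2 squaring is additive and the cross terms α_i α_{n-i} of a Cauchy square
-- cancel in pairs, so (A²)_{2k} = α_k² and (A²)_{2k+1} = 0.  Each of the three summands of
-- σ(A²) therefore vanishes in odd degree, and in degree 2k it is the square of the same summand
-- of σ(A) in degree k: 2^{m+1} = 2k iff 2^m = k, only even indices i = 2j contribute to the
-- binomial sum, and binom(2k, 2j) ≡ binom(k, j) (mod 2).  Additivity of squaring then gives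
-- σ(A²)_{2k} = σ(A)_k² = (σ(A)²)_{2k}.

open import Defs
open import Data.Nat using (ℕ)
open import Algebra.Bundles using (CommutativeRing)
open import Data.Nat as ℕ using (zero; suc; _∸_; _<_; _≤_; _%_; _<?_; _≟_)
import Data.Nat.Properties as ℕₚ
open import Data.Nat.Combinatorics using (_C_; nCk+nC[k+1]≡[n+1]C[k+1])
open import Data.Bool using (if_then_else_)
open import Function using (_∘_; _⇔_; mk⇔; Equivalence)
open import Relation.Nullary using (Dec; yes; no; does; contradiction)
open import Relation.Binary.PropositionalEquality as ≡ using (_≡_)
import Algebra.Properties.CommutativeSemigroup as CommSemigroupProperties

module _ where
  open import Data.Nat
  open import Data.Nat.Properties
  open import Data.Nat.DivMod using ([m+kn]%n≡m%n; %-distribˡ-+)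
  open import Data.Nat.Solver using (module +-*-Solver)
  open ≡

  data EvenOrOdd : ℕ → Set where
    even : ∀ k → EvenOrOdd (2 * k)
    odd  : ∀ k → EvenOrOdd (suc (2 * k))

  evenOrOdd : ∀ n → EvenOrOdd n
  evenOrOdd zero = even 0
  evenOrOdd (suc n) with evenOrOdd n
  ... | even k = odd k
  ... | odd k  = subst EvenOrOdd (*-suc 2 k) (even (suc k))

  2*n≡n+n : ∀ n → 2 * n ≡ n + n
  2*n≡n+n n = cong (n +_) (+-identityʳ n)

  n<2^n : ∀ n → n < 2 ^ n
  n<2^n zero    = z<s
  n<2^n (suc n) = begin-strict
    suc n           ≤⟨ n<2^n n ⟩
    2 ^ n           <⟨ m<m+n (2 ^ n) (m^n>0 2 n) ⟩
    2 ^ n + 2 ^ n   ≡⟨ cong (2 ^ n +_) (sym (+-identityʳ (2 ^ n))) ⟩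
    2 ^ suc n       ∎
    where open ≤-Reasoning

  m≤n⇒2^n≢m : ∀ {m n} → m ≤ n → 2 ^ n ≢ m
  m≤n⇒2^n≢m {m} {n} m≤n 2^n≡m = <⇒≱ (subst (n <_) 2^n≡m (n<2^n n)) m≤n

  -- Pascal's rule twice: C(2n+2, 2k+2) = C(2n, 2k) + 2 C(2n, 2k+1) + C(2n, 2k+2).
  [2n]C[2k]%2≡nCk%2 : ∀ n k → ((2 * n) C (2 * k)) % 2 ≡ (n C k) % 2
  [2n]C[2k]%2≡nCk%2 zero    zero    = refl
  [2n]C[2k]%2≡nCk%2 zero    (suc k) = refl
  [2n]C[2k]%2≡nCk%2 (suc n) zero    = refl
  [2n]C[2k]%2≡nCk%2 (suc n) (suc k) = begin
    (2 * suc n C 2 * suc k) % 2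
      ≡⟨ cong₂ (λ p q → (p C q) % 2) (*-suc 2 n) (*-suc 2 k) ⟩
    (suc (suc N) C suc (suc K)) % 2
      ≡⟨ cong (_% 2) (sym (trans (cong₂ _+_ (pascal N K) (pascal N (suc K))) (pascal (suc N) (suc K)))) ⟩
    ((a + b) + (b + c)) % 2
      ≡⟨ cong (_% 2) (solve 3 (λ a b c → (a :+ b) :+ (b :+ c) := (a :+ c) :+ b :* con 2) refl a b c) ⟩
    ((a + c) + b * 2) % 2
      ≡⟨ [m+kn]%n≡m%n (a + c) b 2 ⟩
    (a + c) % 2
      ≡⟨ %-distribˡ-+ a c 2 ⟩
    (a % 2 + c % 2) % 2
      ≡⟨ cong₂ (λ p q → (p + q) % 2) ([2n]C[2k]%2≡nCk%2 n k) c%2≡nC[k+1]%2 ⟩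
    ((n C k) % 2 + (n C suc k) % 2) % 2
      ≡⟨ %-distribˡ-+ (n C k) (n C suc k) 2 ⟨
    (n C k + n C suc k) % 2
      ≡⟨ cong (_% 2) (pascal n k) ⟩
    (suc n C suc k) % 2 ∎
    where
    open ≡-Reasoning
    open +-*-Solver
    pascal : ∀ n k → n C k + n C suc k ≡ suc n C suc k
    pascal = nCk+nC[k+1]≡[n+1]C[k+1]
    N K a b c : ℕ
    N = 2 * n
    K = 2 * k
    a = N C K
    b = N C suc K
    c = N C suc (suc K)
    c%2≡nC[k+1]%2 : c % 2 ≡ (n C suc k) % 2
    c%2≡nC[k+1]%2 = trans (cong (λ q → (N C q) % 2) (sym (*-suc 2 k))) ([2n]C[2k]%2≡nCk%2 n (suc k))

module AnyCommutativeRing {c ℓ} (R : CommutativeRing c ℓ) where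
  open CommutativeRing R
  open Series R
  open import Relation.Binary.Reasoning.Setoid setoid
  private module +-Properties = CommSemigroupProperties +-commutativeSemigroup

  sumTo-cong : ∀ n {f g : ℕ → Carrier} → (∀ i → i < n → f i ≈ g i) → sumTo n f ≈ sumTo n g
  sumTo-cong zero    f≈g = refl
  sumTo-cong (suc n) f≈g = +-cong (sumTo-cong n (λ i i<n → f≈g i (ℕₚ.m<n⇒m<1+n i<n))) (f≈g n (ℕₚ.n<1+n n))

  sumTo-zero : ∀ n {f : ℕ → Carrier} → (∀ i → i < n → f i ≈ 0#) → sumTo n f ≈ 0#
  sumTo-zero zero    f≈0 = refl
  sumTo-zero (suc n) f≈0 = trans (+-cong (sumTo-zero n (λ i i<n → f≈0 i (ℕₚ.m<n⇒m<1+n i<n))) (f≈0 n (ℕₚ.n<1+n n))) (+-identityʳ 0#)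

  sumTo-suc : ∀ n f → sumTo (suc n) f ≈ f 0 + sumTo n (f ∘ suc)
  sumTo-suc zero    f = +-comm 0# (f 0)
  sumTo-suc (suc n) f = begin
    sumTo (suc n) f + f (suc n)               ≈⟨ +-congʳ (sumTo-suc n f) ⟩
    (f 0 + sumTo n (f ∘ suc)) + f (suc n)     ≈⟨ +-assoc _ _ _ ⟩
    f 0 + sumTo (suc n) (f ∘ suc)             ∎

  sumTo-+ : ∀ m n f → sumTo (m ℕ.+ n) f ≈ sumTo m f + sumTo n (λ i → f (m ℕ.+ i))
  sumTo-+ m zero    f = begin
    sumTo (m ℕ.+ 0) f ≡⟨ ≡.cong (λ k → sumTo k f) (ℕₚ.+-identityʳ m) ⟩
    sumTo m f         ≈⟨ +-identityʳ _ ⟨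
    sumTo m f + 0#    ∎
  sumTo-+ m (suc n) f = begin
    sumTo (m ℕ.+ suc n) f                                       ≡⟨ ≡.cong (λ k → sumTo k f) (ℕₚ.+-suc m n) ⟩
    sumTo (m ℕ.+ n) f + f (m ℕ.+ n)                             ≈⟨ +-congʳ (sumTo-+ m n f) ⟩
    (sumTo m f + sumTo n (λ i → f (m ℕ.+ i))) + f (m ℕ.+ n)     ≈⟨ +-assoc _ _ _ ⟩
    sumTo m f + sumTo (suc n) (λ i → f (m ℕ.+ i))               ∎

  sumTo-reverse : ∀ n f → sumTo n f ≈ sumTo n (λ i → f (n ∸ suc i))
  sumTo-reverse zero    f = refl
  sumTo-reverse (suc n) f = begin
    sumTo n f + f n                         ≈⟨ +-congʳ (sumTo-reverse n f) ⟩
    sumTo n (λ i → f (n ∸ suc i)) + f n     ≈⟨ +-comm _ _ ⟩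
    f n + sumTo n (λ i → f (n ∸ suc i))     ≈⟨ sumTo-suc n (λ i → f (n ∸ i)) ⟨
    sumTo (suc n) (λ i → f (n ∸ i))         ∎

  sumTo-trailing-zeros : ∀ {m n} f → m ≤ n → (∀ i → m ≤ i → f i ≈ 0#) → sumTo n f ≈ sumTo m f
  sumTo-trailing-zeros {m} {n} f m≤n f≈0 = begin
    sumTo n f                                       ≡⟨ ≡.cong (λ k → sumTo k f) (ℕₚ.m+[n∸m]≡n m≤n) ⟨
    sumTo (m ℕ.+ (n ∸ m)) f                         ≈⟨ sumTo-+ m (n ∸ m) f ⟩
    sumTo m f + sumTo (n ∸ m) (λ i → f (m ℕ.+ i))   ≈⟨ +-congˡ (sumTo-zero (n ∸ m) (λ i _ → f≈0 (m ℕ.+ i) (ℕₚ.m≤m+n m i))) ⟩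
    sumTo m f + 0#                                  ≈⟨ +-identityʳ _ ⟩
    sumTo m f                                       ∎

  sumTo-evens-odds : ∀ k f → sumTo (suc (2 ℕ.* k)) f ≈ sumTo (suc k) (f ∘ (2 ℕ.*_)) + sumTo k (f ∘ suc ∘ (2 ℕ.*_))
  sumTo-evens-odds zero    f = sym (+-identityʳ _)
  sumTo-evens-odds (suc k) f = begin
    sumTo (suc (2 ℕ.* suc k)) f                          ≡⟨ ≡.cong (λ n → sumTo (suc n) f) (ℕₚ.*-suc 2 k) ⟩
    (sumTo (suc (2 ℕ.* k)) f + f (suc (2 ℕ.* k))) + f (2 ℕ.+ 2 ℕ.* k)
                                                         ≈⟨ +-congʳ (+-congʳ (sumTo-evens-odds k f)) ⟩
    ((E + O) + f (suc (2 ℕ.* k))) + f (2 ℕ.+ 2 ℕ.* k)    ≈⟨ +-congʳ (+-assoc E O _) ⟩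
    (E + (O + f (suc (2 ℕ.* k)))) + f (2 ℕ.+ 2 ℕ.* k)    ≈⟨ +-Properties.xy∙z≈xz∙y E _ _ ⟩
    (E + f (2 ℕ.+ 2 ℕ.* k)) + (O + f (suc (2 ℕ.* k)))    ≡⟨ ≡.cong (λ n → (E + f n) + (O + f (suc (2 ℕ.* k)))) (ℕₚ.*-suc 2 k) ⟨
    sumTo (suc (suc k)) (f ∘ (2 ℕ.*_)) + sumTo (suc k) (f ∘ suc ∘ (2 ℕ.*_)) ∎
    where
    E O : Carrier
    E = sumTo (suc k) (f ∘ (2 ℕ.*_))
    O = sumTo k (f ∘ suc ∘ (2 ℕ.*_))

  HasCharacteristicTwo : Set ℓ
  HasCharacteristicTwo = 1# + 1# ≈ 0#

  square : Carrier → Carrier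
  square x = x * x

  square-0# : square 0# ≈ 0#
  square-0# = zeroˡ 0#

  if-≈0 : ∀ {p} {P : Set p} (d : Dec P) {x} → (P → x ≈ 0#) → (if does d then x else 0#) ≈ 0#
  if-≈0 (yes p) x≈0 = x≈0 p
  if-≈0 (no _)  x≈0 = refl

  if-square : ∀ {p q} {P : Set p} {Q : Set q} (d : Dec P) (e : Dec Q) {x y} → P ⇔ Q →
              (P → x ≈ square y) → (if does d then x else 0#) ≈ square (if does e then y else 0#)
  if-square (yes p) (yes q) P⇔Q x≈y² = x≈y² p
  if-square (yes p) (no ¬q) P⇔Q x≈y² = contradiction (Equivalence.to P⇔Q p) ¬q
  if-square (no ¬p) (yes q) P⇔Q x≈y² = contradiction (Equivalence.from P⇔Q q) ¬p
  if-square (no ¬p) (no ¬q) P⇔Q x≈y² = sym square-0#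

  oddCoeff-≈0 : ∀ m {x} → x ≈ 0# → oddCoeff m x ≈ 0#
  oddCoeff-≈0 m x≈0 = if-≈0 (m % 2 ≟ 1) (λ _ → x≈0)

  oddCoeff-square : ∀ m m′ → m % 2 ≡ m′ % 2 → ∀ {x y} → x ≈ square y → oddCoeff m x ≈ square (oddCoeff m′ y)
  oddCoeff-square m m′ m≡m′ x≈y² =
    if-square (m % 2 ≟ 1) (m′ % 2 ≟ 1) (mk⇔ (≡.trans (≡.sym m≡m′)) (≡.trans m≡m′)) (λ _ → x≈y²)

module CharacteristicTwo {c ℓ} (R : CommutativeRing c ℓ)
                         (char2 : AnyCommutativeRing.HasCharacteristicTwo R) where
  open CommutativeRing R
  open Series R
  open AnyCommutativeRing R
  open import Relation.Binary.Reasoning.Setoid setoid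
  private
    module +-Properties = CommSemigroupProperties +-commutativeSemigroup
    module *-Properties = CommSemigroupProperties *-commutativeSemigroup

  x+x≈0# : ∀ x → x + x ≈ 0#
  x+x≈0# x = begin
    x + x               ≈⟨ +-cong (*-identityˡ x) (*-identityˡ x) ⟨
    1# * x + 1# * x     ≈⟨ distribʳ x 1# 1# ⟨
    (1# + 1#) * x       ≈⟨ *-congʳ char2 ⟩
    0# * x              ≈⟨ zeroˡ x ⟩
    0#                  ∎

  square-+ : ∀ x y → square (x + y) ≈ square x + square y
  square-+ x y = begin
    (x + y) * (x + y)                        ≈⟨ distribʳ (x + y) x y ⟩
    x * (x + y) + y * (x + y)                ≈⟨ +-cong (distribˡ x x y) (distribˡ y x y) ⟩
    (x * x + x * y) + (y * x + y * y)        ≈⟨ +-congˡ (+-comm _ _) ⟩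
    (x * x + x * y) + (y * y + y * x)        ≈⟨ +-Properties.interchange _ _ _ _ ⟩
    (x * x + y * y) + (x * y + y * x)        ≈⟨ +-congˡ (trans (+-congˡ (*-comm y x)) (x+x≈0# (x * y))) ⟩
    (x * x + y * y) + 0#                     ≈⟨ +-identityʳ _ ⟩
    square x + square y                      ∎

  square-sumTo : ∀ n f → square (sumTo n f) ≈ sumTo n (square ∘ f)
  square-sumTo zero    f = square-0#
  square-sumTo (suc n) f = trans (square-+ _ _) (+-congʳ (square-sumTo n f))

  sumTo-palindrome-even : ∀ k h → (∀ i → i ≤ 2 ℕ.* k → h (2 ℕ.* k ∸ i) ≈ h i) →
                          sumTo (suc (2 ℕ.* k)) h ≈ h k
  sumTo-palindrome-even k h palindrome = begin
    sumTo (suc (2 ℕ.* k)) h                                  ≡⟨ ≡.cong (λ n → sumTo n h) length≡ ⟩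
    sumTo (k ℕ.+ suc k) h                                    ≈⟨ sumTo-+ k (suc k) h ⟩
    S + sumTo (suc k) (λ i → h (k ℕ.+ i))                    ≈⟨ +-congˡ (sumTo-suc k _) ⟩
    S + (h (k ℕ.+ 0) + sumTo k (λ i → h (k ℕ.+ suc i)))      ≈⟨ +-congˡ (+-cong (reflexive (≡.cong h (ℕₚ.+-identityʳ k))) (sumTo-reverse k _)) ⟩
    S + (h k + sumTo k (λ i → h (k ℕ.+ suc (k ∸ suc i))))    ≈⟨ +-congˡ (+-congˡ (sumTo-cong k mirror)) ⟩
    S + (h k + S)                                            ≈⟨ +-Properties.x∙yz≈y∙xz _ _ _ ⟩
    h k + (S + S)                                            ≈⟨ +-congˡ (x+x≈0# S) ⟩
    h k + 0#                                                 ≈⟨ +-identityʳ _ ⟩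
    h k                                                      ∎
    where
    S : Carrier
    S = sumTo k h
    length≡ : suc (2 ℕ.* k) ≡ k ℕ.+ suc k
    length≡ = ≡.trans (≡.cong suc (2*n≡n+n k)) (≡.sym (ℕₚ.+-suc k k))
    mirror : ∀ i → i < k → h (k ℕ.+ suc (k ∸ suc i)) ≈ h i
    mirror i i<k = trans (reflexive (≡.cong h index≡)) (palindrome i (ℕₚ.≤-trans (ℕₚ.<⇒≤ i<k) (ℕₚ.m≤m+n k _)))
      where
      index≡ : k ℕ.+ suc (k ∸ suc i) ≡ 2 ℕ.* k ∸ i
      index≡ = ≡.trans (≡.cong (k ℕ.+_) (≡.sym (ℕₚ.+-∸-assoc 1 i<k)))
                (≡.trans (≡.sym (ℕₚ.+-∸-assoc k (ℕₚ.<⇒≤ i<k))) (≡.cong (_∸ i) (≡.sym (2*n≡n+n k))))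

  sumTo-palindrome-odd : ∀ k h → (∀ i → i ≤ suc (2 ℕ.* k) → h (suc (2 ℕ.* k) ∸ i) ≈ h i) →
                         sumTo (suc (suc (2 ℕ.* k))) h ≈ 0#
  sumTo-palindrome-odd k h palindrome = begin
    sumTo (suc (suc (2 ℕ.* k))) h                        ≡⟨ ≡.cong (λ n → sumTo n h) length≡ ⟩
    sumTo (suc k ℕ.+ suc k) h                            ≈⟨ sumTo-+ (suc k) (suc k) h ⟩
    S + sumTo (suc k) (λ i → h (suc k ℕ.+ i))            ≈⟨ +-congˡ (sumTo-reverse (suc k) _) ⟩
    S + sumTo (suc k) (λ i → h (suc k ℕ.+ (k ∸ i)))      ≈⟨ +-congˡ (sumTo-cong (suc k) mirror) ⟩
    S + S                                                ≈⟨ x+x≈0# S ⟩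
    0#                                                   ∎
    where
    S : Carrier
    S = sumTo (suc k) h
    length≡ : suc (suc (2 ℕ.* k)) ≡ suc k ℕ.+ suc k
    length≡ = ≡.cong suc (≡.trans (≡.cong suc (2*n≡n+n k)) (≡.sym (ℕₚ.+-suc k k)))
    mirror : ∀ i → i < suc k → h (suc k ℕ.+ (k ∸ i)) ≈ h i
    mirror i (ℕ.s≤s i≤k) = trans (reflexive (≡.cong h index≡)) (palindrome i (ℕₚ.m≤n⇒m≤1+n (ℕₚ.≤-trans i≤k (ℕₚ.m≤m+n k _))))
      where
      index≡ : suc k ℕ.+ (k ∸ i) ≡ suc (2 ℕ.* k) ∸ i
      index≡ = ≡.trans (≡.sym (ℕₚ.+-∸-assoc (suc k) i≤k)) (≡.cong (λ n → suc n ∸ i) (≡.sym (2*n≡n+n k)))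

  sqPS-even : ∀ F k → sqPS F (2 ℕ.* k) ≈ F k * F k
  sqPS-even F k = trans (sumTo-palindrome-even k _ palindrome) (reflexive (≡.cong (λ n → F k * F n) 2k∸k≡k))
    where
    palindrome : ∀ i → i ≤ 2 ℕ.* k → F (2 ℕ.* k ∸ i) * F (2 ℕ.* k ∸ (2 ℕ.* k ∸ i)) ≈ F i * F (2 ℕ.* k ∸ i)
    palindrome i i≤2k = trans (*-congˡ (reflexive (≡.cong F (ℕₚ.m∸[m∸n]≡n i≤2k)))) (*-comm _ _)
    2k∸k≡k : 2 ℕ.* k ∸ k ≡ k
    2k∸k≡k = ≡.trans (≡.cong (_∸ k) (2*n≡n+n k)) (ℕₚ.m+n∸n≡m k k)

  sqPS-odd : ∀ F k → sqPS F (suc (2 ℕ.* k)) ≈ 0#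
  sqPS-odd F k = sumTo-palindrome-odd k _ palindrome
    where
    palindrome : ∀ i → i ≤ suc (2 ℕ.* k) →
                 F (suc (2 ℕ.* k) ∸ i) * F (suc (2 ℕ.* k) ∸ (suc (2 ℕ.* k) ∸ i)) ≈ F i * F (suc (2 ℕ.* k) ∸ i)
    palindrome i i≤n = trans (*-congˡ (reflexive (≡.cong F (ℕₚ.m∸[m∸n]≡n i≤n)))) (*-comm _ _)

  sqPS-*-sqPS≈0 : ∀ F {i j} k → i ℕ.+ j ≡ suc (2 ℕ.* k) → sqPS F i * sqPS F j ≈ 0#
  sqPS-*-sqPS≈0 F {i} {j} k i+j≡odd with evenOrOdd i | evenOrOdd j
  ... | odd a  | _      = trans (*-congʳ (sqPS-odd F a)) (zeroˡ _)
  ... | even a | odd b  = trans (*-congˡ (sqPS-odd F b)) (zeroʳ _)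
  ... | even a | even b = contradiction (≡.trans (ℕₚ.*-distribˡ-+ 2 a b) i+j≡odd) (ℕₚ.even≢odd (a ℕ.+ b) k)

  -- σ A n is definitionally (σ-constant A n + σ-dyadic A n) + σ-binomial A n.
  σ-constant σ-dyadic σ-binomial : PowerSeries → PowerSeries
  σ-constant A n = if does (n ≟ 0) then A 0 * A 0 else 0#
  σ-dyadic   A n = sumTo n (λ m → if does (2 ℕ.^ suc m ≟ n) then A (2 ℕ.^ m) * A (2 ℕ.^ m) else 0#)
  σ-binomial A n = sumTo (suc n) (λ i → if does (i <? n ∸ i) then oddCoeff (n C i) (A i * A (n ∸ i)) else 0#)

  module _ (A : PowerSeries) where
    private
      B : PowerSeries
      B = sqPS A

    σ-constant-even : ∀ k → σ-constant B (2 ℕ.* k) ≈ square (σ-constant A k)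
    σ-constant-even zero    = *-cong (sqPS-even A 0) (sqPS-even A 0)
    σ-constant-even (suc k) = sym square-0#

    σ-constant-odd : ∀ k → σ-constant B (suc (2 ℕ.* k)) ≈ 0#
    σ-constant-odd k = refl

    σ-dyadic-even : ∀ k → σ-dyadic B (2 ℕ.* k) ≈ square (σ-dyadic A k)
    σ-dyadic-even k = begin
      sumTo (2 ℕ.* k) f              ≈⟨ sumTo-trailing-zeros f (ℕₚ.m≤m+n k _) vanishes ⟩
      sumTo k f                      ≈⟨ sumTo-trailing-zeros f (ℕₚ.n≤1+n k) vanishes ⟨
      sumTo (suc k) f                ≈⟨ sumTo-suc k f ⟩
      f 0 + sumTo k (f ∘ suc)        ≈⟨ +-cong f0≈0 (sumTo-cong k (λ m _ → f[1+m]≈g[m]² m)) ⟩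
      0# + sumTo k (square ∘ g)      ≈⟨ +-identityˡ _ ⟩
      sumTo k (square ∘ g)           ≈⟨ square-sumTo k g ⟨
      square (sumTo k g)             ∎
      where
      f g : ℕ → Carrier
      f m = if does (2 ℕ.^ suc m ≟ 2 ℕ.* k) then B (2 ℕ.^ m) * B (2 ℕ.^ m) else 0#
      g m = if does (2 ℕ.^ suc m ≟ k) then A (2 ℕ.^ m) * A (2 ℕ.^ m) else 0#
      vanishes : ∀ m → k ≤ m → f m ≈ 0#
      vanishes m k≤m = if-≈0 (2 ℕ.^ suc m ≟ 2 ℕ.* k)
        (λ 2^[1+m]≡2k → contradiction (ℕₚ.*-cancelˡ-≡ _ _ 2 2^[1+m]≡2k) (m≤n⇒2^n≢m k≤m))
      f0≈0 : f 0 ≈ 0#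
      f0≈0 = if-≈0 (2 ≟ 2 ℕ.* k) (λ _ → trans (*-congʳ (sqPS-odd A 0)) (zeroˡ _))
      f[1+m]≈g[m]² : ∀ m → f (suc m) ≈ square (g m)
      f[1+m]≈g[m]² m = if-square (2 ℕ.^ suc (suc m) ≟ 2 ℕ.* k) (2 ℕ.^ suc m ≟ k)
        (mk⇔ (ℕₚ.*-cancelˡ-≡ _ _ 2) (≡.cong (2 ℕ.*_)))
        (λ _ → *-cong (sqPS-even A (2 ℕ.^ m)) (sqPS-even A (2 ℕ.^ m)))

    σ-dyadic-odd : ∀ k → σ-dyadic B (suc (2 ℕ.* k)) ≈ 0#
    σ-dyadic-odd k = sumTo-zero (suc (2 ℕ.* k)) λ m _ →
      if-≈0 (2 ℕ.^ suc m ≟ suc (2 ℕ.* k)) (λ 2^[1+m]≡odd → contradiction 2^[1+m]≡odd (ℕₚ.even≢odd (2 ℕ.^ m) k))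

    σ-binomial-even : ∀ k → σ-binomial B (2 ℕ.* k) ≈ square (σ-binomial A k)
    σ-binomial-even k = begin
      sumTo (suc (2 ℕ.* k)) f                                                 ≈⟨ sumTo-evens-odds k f ⟩
      sumTo (suc k) (f ∘ (2 ℕ.*_)) + sumTo k (f ∘ suc ∘ (2 ℕ.*_))             ≈⟨ +-cong (sumTo-cong (suc k) (λ j _ → f[2j]≈g[j]² j)) (sumTo-zero k (λ j _ → f[1+2j]≈0 j)) ⟩
      sumTo (suc k) (square ∘ g) + 0#                                         ≈⟨ +-identityʳ _ ⟩
      sumTo (suc k) (square ∘ g)                                              ≈⟨ square-sumTo (suc k) g ⟨
      square (sumTo (suc k) g)                                                ∎
      where
      f g : ℕ → Carrier
      f i = if does (i <? 2 ℕ.* k ∸ i) then oddCoeff ((2 ℕ.* k) C i) (B i * B (2 ℕ.* k ∸ i)) else 0#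
      g j = if does (j <? k ∸ j) then oddCoeff (k C j) (A j * A (k ∸ j)) else 0#
      f[1+2j]≈0 : ∀ j → f (suc (2 ℕ.* j)) ≈ 0#
      f[1+2j]≈0 j = if-≈0 (suc (2 ℕ.* j) <? 2 ℕ.* k ∸ suc (2 ℕ.* j))
        (λ _ → oddCoeff-≈0 ((2 ℕ.* k) C suc (2 ℕ.* j)) (trans (*-congʳ (sqPS-odd A j)) (zeroˡ _)))
      f[2j]≈g[j]² : ∀ j → f (2 ℕ.* j) ≈ square (g j)
      f[2j]≈g[j]² j = ≡.subst (λ e → term e ≈ square (g j)) (ℕₚ.*-distribˡ-∸ 2 k j)
        (if-square (2 ℕ.* j <? 2 ℕ.* (k ∸ j)) (j <? k ∸ j)
          (mk⇔ (ℕₚ.*-cancelˡ-< 2 _ _) (ℕₚ.*-monoʳ-< 2))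
          (λ _ → oddCoeff-square ((2 ℕ.* k) C (2 ℕ.* j)) (k C j) ([2n]C[2k]%2≡nCk%2 k j)
                   (trans (*-cong (sqPS-even A j) (sqPS-even A (k ∸ j))) (*-Properties.interchange _ _ _ _))))
        where
        term : ℕ → Carrier
        term e = if does (2 ℕ.* j <? e) then oddCoeff ((2 ℕ.* k) C (2 ℕ.* j)) (B (2 ℕ.* j) * B e) else 0#

    σ-binomial-odd : ∀ k → σ-binomial B (suc (2 ℕ.* k)) ≈ 0#
    σ-binomial-odd k = sumTo-zero (suc (suc (2 ℕ.* k))) λ i i<n →
      if-≈0 (i <? suc (2 ℕ.* k) ∸ i)
        (λ _ → oddCoeff-≈0 (suc (2 ℕ.* k) C i) (sqPS-*-sqPS≈0 A k (ℕₚ.m+[n∸m]≡n (ℕₚ.<⇒≤pred i<n))))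

    σ-sqPS-even : ∀ k → σ B (2 ℕ.* k) ≈ square (σ A k)
    σ-sqPS-even k = begin
      σ B (2 ℕ.* k)                                                        ≈⟨ +-cong (+-cong (σ-constant-even k) (σ-dyadic-even k)) (σ-binomial-even k) ⟩
      (square (σ-constant A k) + square (σ-dyadic A k)) + square (σ-binomial A k) ≈⟨ +-congʳ (square-+ _ _) ⟨
      square (σ-constant A k + σ-dyadic A k) + square (σ-binomial A k)     ≈⟨ square-+ _ _ ⟨
      square (σ A k)                                                       ∎

    σ-sqPS-odd : ∀ k → σ B (suc (2 ℕ.* k)) ≈ 0#
    σ-sqPS-odd k = begin
      σ B (suc (2 ℕ.* k))   ≈⟨ +-cong (+-cong (σ-constant-odd k) (σ-dyadic-odd k)) (σ-binomial-odd k) ⟩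
      (0# + 0#) + 0#        ≈⟨ trans (+-identityʳ _) (+-identityʳ 0#) ⟩
      0#                    ∎

    σ-sqPS≈sqPS-σ : ∀ n → σ (sqPS A) n ≈ sqPS (σ A) n
    σ-sqPS≈sqPS-σ n with evenOrOdd n
    ... | even k = trans (σ-sqPS-even k) (sym (sqPS-even (σ A) k))
    ... | odd k  = trans (σ-sqPS-odd k) (sym (sqPS-odd (σ A) k))

proposition4p2 : ∀ {c ℓ} (R : CommutativeRing c ℓ) →
    Series.IsAlgClosureF2 R →
    ∀ (A : Series.PowerSeries R) (n : ℕ) →
      CommutativeRing._≈_ R (Series.σ R (Series.sqPS R A) n) (Series.sqPS R (Series.σ R A) n)
proposition4p2 R closure = CharacteristicTwo.σ-sqPS≈sqPS-σ R (Series.IsAlgClosureF2.char2 closure)
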